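{- Let $c>b>a\ge 2$ be pairwise coprime integers, let $k=\lfloor c/b\rfloor$, let $\ell\in\{0,1,\ldots,a-1\}$ with $\ell\equiv cb^{ -1}\pmod a$, let $q=\lfloor a/(a-\ell)\rfloor$, $r=a-q(a-\ell)$, and $u=(a-\ell)\bmod r$. Suppose $\ell>k$ and $br>cq$. Define $A=br-cq$, $B=b(a-\ell-r)+c(q+1)$, $\Lambda=\lfloor\tfrac{r}{a-\ell-r}\rfloor$, $\Delta=\lfloor\tfrac{A}{B}\rfloor$, $\Lambda'=\lfloor\tfrac{a-\ell-r}{r}\rfloor$, $\Delta'=\lfloor\tfrac{B}{A}\rfloor$, and $$\mu=\min\left\{i\in\mathbb{Z}_{\ge0}\,\Big|\,\left\lfloor\tfrac{(i+1)B}{A}\right\rfloor\ne\left\lfloor\tfrac{(i+1)(a-\ell-r)}{r}\right\rfloor\right\}.$$ Let $\mathscr{X}=\{x\in\{1,\ldots,r\}\mid \mathbf{m}(bx)\equiv 0\pmod c\}$. Then $$\mathscr{X}=\left\{r\left(\left\lfloor\tfrac{(a-\ell-r)t}{r}\right\rfloor+1\right)-(a-\ell-r)t\,\Big|\,0\le t\le\mu\right\},$$ equivalently, $\mathscr{X}$ consists of the representatives in $\{1,\ldots,r\}$ of $r-(a-\ell-r)t$ modulo $r$ for $0\le t\le\mu$. Furthermore, if $\mu<\lfloor r/u\rfloor$, then $\mathscr{X}=\{r-ut\mid 0\le t\le\mu\}$. In particular, if $\Lambda>\Delta$ or $\Delta'>\Lambda'$, then $\mathscr{X}=\{r-(a-\ell-r)t\mid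 0\le t\le\Delta\}$.
   Context: Reductions modulo $n$ are taken in $\{0,1,\ldots,n-1\}$ unless stated otherwise. For an integer $z$, $\mathbf{m}(z)$ denotes the least positive integer of the form $bn_1+cn_2$ with $n_1,n_2$ non-negative integers that is congruent to $z$ modulo $a$. -}

module Defs where

open import Data.Nat using (ℕ; zero; suc; _+_; _*_; _≤_; _<_)
open import Data.Nat.DivMod using (_/_; _%_)
open import Data.Nat.Divisibility using (_∣_)
open import Data.Product using (Σ; ∃₂; _×_)
open import Relation.Binary.PropositionalEquality using (_≡_)

-- Floor division with the convention ⌊m/0⌋ = 0 (only ever used with
-- nonzero divisors in the theorem, under its hypotheses).
_div_ : ℕ → ℕ → ℕ
m div zero = zero
m div suc n = m / suc n

_mod_ : ℕ → ℕ → ℕ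
m mod zero = m
m mod suc n = m % suc n

Repr : (b c v : ℕ) → Set
Repr b c v = ∃₂ λ n₁ n₂ → v ≡ b * n₁ + c * n₂

-- IsM a b c z v  :⇔  v = 𝐦(z), i.e. v is the least positive integer of the form
-- b n₁ + c n₂ (n₁,n₂ ≥ 0) congruent to z modulo a.
IsM : (a b c z v : ℕ) → Set
IsM a b c z v =
  (0 < v) × Repr b c v × (v mod a ≡ z mod a) ×
  (∀ w → 0 < w → Repr b c w → w mod a ≡ z mod a → v ≤ w)

InX : (a b c r x : ℕ) → Set
InX a b c r x = (1 ≤ x) × (x ≤ r) × Σ ℕ (λ v → IsM a b c (b * x) v × c ∣ v)

{-# OPTIONS --safe #-}
module Submission where

-- Since ℓ b ≡ c (mod a), c k ≡ b (ℓ k) (mod a); so 𝐦(b x) is a multiple c k of c exactly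
-- when x = ℓ k mod a and no b (ℓ m mod a) + c (k − m) with m ≤ k undercuts c k, i.e. when
-- c m ≤ b (ℓ m mod a) for all m ≤ k.  Put d = a − ℓ, so that a = q d + r and d = s + r.
-- The m whose residue Y = ℓ m mod a is at most r are exactly the m = q i + (1 + q) t with
-- Y + s t = r i, and for them b Y − c m = i A − t B; an m with a larger residue is handled
-- through m − q, whose residue is smaller by r.  Consequently 𝒳 consists of the
-- x_t = r (1 + ⌊s t / r⌋) − s t for which t′ B ≤ (1 + ⌊s t′ / r⌋) A for all t′ ≤ t.
-- As s A < r B, always ⌊t′ B / A⌋ ≥ ⌊s t′ / r⌋, and t′ B = (1 + ⌊s t′ / r⌋) A would make
-- c divide b x_t′; so the condition says ⌊t′ B / A⌋ = ⌊s t′ / r⌋ for 1 ≤ t′ ≤ t, that is,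
-- t ≤ μ.  The other two descriptions of 𝒳 evaluate ⌊s t / r⌋ in ranges where it is
-- linear in t.

open import Data.Empty using (⊥-elim)
open import Data.Nat
open import Data.Nat.Coprimality using (Coprime; coprime-divisor)
import Data.Nat.Coprimality as Coprimality
open import Data.Nat.DivMod hiding (_div_; _mod_)
open import Data.Nat.Divisibility
open import Data.Nat.Induction using (<-rec)
open import Data.Nat.Properties
open import Data.Nat.Tactic.RingSolver using (solve-∀)
open import Data.Product using (Σ; ∃; ∃₂; _×_; _,_)
open import Data.Sum using (_⊎_; inj₁; inj₂)
open import Function.Bundles using (_⇔_; mk⇔; Equivalence)
open import Relation.Binary.Bundles using (Setoid)
open import Relation.Binary.PropositionalEquality
import Relation.Binary.Reasoning.Setoid as SetoidReasoning
open import Relation.Nullary using (yes; no)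

open import Defs

-- Floor division and remainder

mod≡% : ∀ m n .{{_ : NonZero n}} → m mod n ≡ m % n
mod≡% m (suc n) = refl

m≡m-mod-n+[m-div-n]*n : ∀ m n .{{_ : NonZero n}} → m ≡ m mod n + m div n * n
m≡m-mod-n+[m-div-n]*n m (suc n) = m≡m%n+[m/n]*n m (suc n)

m-div-n*n≤m : ∀ m n .{{_ : NonZero n}} → m div n * n ≤ m
m-div-n*n≤m m (suc n) = m/n*n≤m m (suc n)

m<[1+m-div-n]*n : ∀ m n .{{_ : NonZero n}} → m < suc (m div n) * n
m<[1+m-div-n]*n m (suc n) = begin-strict
  m                             ≡⟨ m≡m%n+[m/n]*n m (suc n) ⟩
  m % suc n + m / suc n * suc n <⟨ +-monoˡ-< (m / suc n * suc n) (m%n<n m (suc n)) ⟩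
  suc (m / suc n) * suc n       ∎
  where open ≤-Reasoning

n*o≤m⇒n≤m-div-o : ∀ {m n} o .{{_ : NonZero o}} → n * o ≤ m → n ≤ m div o
n*o≤m⇒n≤m-div-o {m} {n} (suc o) n*o≤m = begin
  n                 ≡⟨ m*n/n≡m n (suc o) ⟨
  n * suc o / suc o ≤⟨ /-monoˡ-≤ (suc o) n*o≤m ⟩
  m / suc o         ∎
  where open ≤-Reasoning

m<n*o⇒m-div-o<n : ∀ {m n} o .{{_ : NonZero o}} → m < n * o → m div o < n
m<n*o⇒m-div-o<n (suc o) = m<n*o⇒m/o<n

div-unique : ∀ {m f} n .{{_ : NonZero n}} → f * n ≤ m → m < suc f * n → m div n ≡ f
div-unique n lower upper =
  ≤-antisym (s≤s⁻¹ (m<n*o⇒m-div-o<n n upper)) (n*o≤m⇒n≤m-div-o n lower)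

m*n-div-n≡m : ∀ m n .{{_ : NonZero n}} → (m * n) div n ≡ m
m*n-div-n≡m m (suc n) = m*n/n≡m m (suc n)

m<n⇒m-div-n≡0 : ∀ {m} n .{{_ : NonZero n}} → m < n → m div n ≡ 0
m<n⇒m-div-n≡0 (suc n) = m<n⇒m/n≡0

n-div-n≡1 : ∀ n .{{_ : NonZero n}} → n div n ≡ 1
n-div-n≡1 (suc n) = n/n≡1 (suc n)

[m+n]-mod-n≡m-mod-n : ∀ m n .{{_ : NonZero n}} → (m + n) mod n ≡ m mod n
[m+n]-mod-n≡m-mod-n m (suc n) = [m+n]%n≡m%n m (suc n)

∣∧<⇒≡0 : ∀ {m n} → n ∣ m → m < n → m ≡ 0
∣∧<⇒≡0 {zero}  _   _   = refl
∣∧<⇒≡0 {suc m} n∣m m<n = ⊥-elim (>⇒∤ m<n n∣m)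

m+[n∸m%n]≡[1+m/n]*n : ∀ m n .{{_ : NonZero n}} → m + (n ∸ m % n) ≡ suc (m / n) * n
m+[n∸m%n]≡[1+m/n]*n m n = begin
  m + m′                    ≡⟨ cong (_+ m′) (m≡m%n+[m/n]*n m n) ⟩
  m % n + m / n * n + m′    ≡⟨ +-assoc (m % n) _ m′ ⟩
  m % n + (m / n * n + m′)  ≡⟨ cong (m % n +_) (+-comm (m / n * n) m′) ⟩
  m % n + (m′ + m / n * n)  ≡⟨ +-assoc (m % n) m′ _ ⟨
  m % n + m′ + m / n * n    ≡⟨ cong (_+ m / n * n) (m+[n∸m]≡n (m%n≤n m n)) ⟩
  n + m / n * n             ∎
  where
  open ≡-Reasoning
  m′ = n ∸ m % n

Y+ts≡ri⇒i≡1+⌊st/r⌋ : ∀ {Y t s r i} .{{_ : NonZero r}} → 0 < Y → Y ≤ r →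
                      Y + t * s ≡ r * i → i ≡ suc ((s * t) div r)
Y+ts≡ri⇒i≡1+⌊st/r⌋ {Y} {t} {s} {r} {zero} 0<Y _ Y+ts≡0 =
  ⊥-elim (<⇒≢ 0<Y (sym (m+n≡0⇒m≡0 Y (trans Y+ts≡0 (*-zeroʳ r)))))
Y+ts≡ri⇒i≡1+⌊st/r⌋ {Y} {t} {s} {r} {suc p} 0<Y Y≤r Y+ts≡ri =
  cong suc (sym (div-unique r lower upper))
  where
  Y+ts≡r+pr : Y + s * t ≡ r + p * r
  Y+ts≡r+pr = begin
    Y + s * t   ≡⟨ cong (Y +_) (*-comm s t) ⟩
    Y + t * s   ≡⟨ Y+ts≡ri ⟩
    r * suc p   ≡⟨ *-suc r p ⟩
    r + r * p   ≡⟨ cong (r +_) (*-comm r p) ⟩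
    r + p * r   ∎
    where open ≡-Reasoning
  lower : p * r ≤ s * t
  lower = +-cancelˡ-≤ Y (p * r) (s * t) (begin
    Y + p * r ≤⟨ +-monoˡ-≤ (p * r) Y≤r ⟩
    r + p * r ≡⟨ Y+ts≡r+pr ⟨
    Y + s * t ∎)
    where open ≤-Reasoning
  upper : s * t < suc p * r
  upper = begin-strict
    s * t     <⟨ m<n+m (s * t) 0<Y ⟩
    Y + s * t ≡⟨ Y+ts≡r+pr ⟩
    r + p * r ∎
    where open ≤-Reasoning

m<n-div-o⇒o*m<n : ∀ {m n} o .{{_ : NonZero o}} → m < n div o → o * m < n
m<n-div-o⇒o*m<n {m} {n} o m<n/o = begin-strict
  o * m         <⟨ *-monoʳ-< o (n<1+n m) ⟩
  o * suc m     ≡⟨ *-comm o (suc m) ⟩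
  suc m * o     ≤⟨ *-monoˡ-≤ o m<n/o ⟩
  n div o * o   ≤⟨ m-div-n*n≤m n o ⟩
  n             ∎
  where open ≤-Reasoning

-- Congruence modulo n

module Congruence (n : ℕ) .{{_ : NonZero n}} where

  -- A record rather than a definition, so that x and z can be inferred from a proof of x ≈ z.
  infix 4 _≈_
  record _≈_ (x z : ℕ) : Set where
    constructor mk≈
    field ≈⇒%≡% : x % n ≡ z % n
  open _≈_ public

  ≈-setoid : Setoid _ _
  ≈-setoid = record
    { Carrier       = ℕ
    ; _≈_           = _≈_
    ; isEquivalence = record
      { refl  = mk≈ refl
      ; sym   = λ (mk≈ e) → mk≈ (sym e)
      ; trans = λ (mk≈ e) (mk≈ f) → mk≈ (trans e f)
      }
    }

  open Setoid ≈-setoid public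
    using () renaming (refl to ≈-refl; sym to ≈-sym; trans to ≈-trans; reflexive to ≈-reflexive)
  module ≈-Reasoning = SetoidReasoning ≈-setoid

  +-cong : ∀ {x x′ z z′} → x ≈ x′ → z ≈ z′ → x + z ≈ x′ + z′
  +-cong {x} {x′} {z} {z′} (mk≈ e) (mk≈ f) = mk≈ (begin
    (x + z) % n           ≡⟨ %-distribˡ-+ x z n ⟩
    (x % n + z % n) % n   ≡⟨ cong₂ (λ u v → (u + v) % n) e f ⟩
    (x′ % n + z′ % n) % n ≡⟨ %-distribˡ-+ x′ z′ n ⟨
    (x′ + z′) % n         ∎)
    where open ≡-Reasoning

  *-congˡ : ∀ k {x z} → x ≈ z → k * x ≈ k * z
  *-congˡ k {x} {z} (mk≈ e) = mk≈ (begin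
    (k * x) % n             ≡⟨ %-distribˡ-* k x n ⟩
    (k % n * (x % n)) % n   ≡⟨ cong (λ v → (k % n * v) % n) e ⟩
    (k % n * (z % n)) % n   ≡⟨ %-distribˡ-* k z n ⟨
    (k * z) % n             ∎)
    where open ≡-Reasoning

  mod-≡⇒≈ : ∀ {x z} → x mod n ≡ z mod n → x ≈ z
  mod-≡⇒≈ {x} {z} e = mk≈ (trans (sym (mod≡% x n)) (trans e (mod≡% z n)))

  ≈⇒mod-≡ : ∀ {x z} → x ≈ z → x mod n ≡ z mod n
  ≈⇒mod-≡ {x} {z} (mk≈ e) = trans (mod≡% x n) (trans e (sym (mod≡% z n)))

  m+kn≈m : ∀ m k → m + k * n ≈ m
  m+kn≈m m k = mk≈ ([m+kn]%n≡m%n m k n)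

  m%n≈m : ∀ m → m % n ≈ m
  m%n≈m m = mk≈ (m%n%n≡m%n m n)

  ≈∧<⇒≡ : ∀ {x z} → x < n → z < n → x ≈ z → x ≡ z
  ≈∧<⇒≡ {x} {z} x<n z<n (mk≈ e) = begin
    x     ≡⟨ m<n⇒m%n≡m x<n ⟨
    x % n ≡⟨ e ⟩
    z % n ≡⟨ m<n⇒m%n≡m z<n ⟩
    z     ∎
    where open ≡-Reasoning

  n≈0 : n ≈ 0
  n≈0 = mk≈ (trans (n%n≡0 n) (sym (m<n⇒m%n≡m (>-nonZero⁻¹ n))))

  ≈0⇒∣ : ∀ {x} → x ≈ 0 → n ∣ x
  ≈0⇒∣ {x} (mk≈ e) = m%n≡0⇒n∣m x n (trans e (m<n⇒m%n≡m (>-nonZero⁻¹ n)))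

  +-cancelʳ : ∀ {x z} w → x + w ≈ z + w → x ≈ z
  +-cancelʳ {x} {z} w x+w≈z+w = begin
    x                    ≈⟨ m+kn≈m x (suc (w / n)) ⟨
    x + suc (w / n) * n  ≡⟨ shift x ⟩
    x + w + w′           ≈⟨ +-cong x+w≈z+w ≈-refl ⟩
    z + w + w′           ≡⟨ shift z ⟨
    z + suc (w / n) * n  ≈⟨ m+kn≈m z (suc (w / n)) ⟩
    z                    ∎
    where
    open ≈-Reasoning
    w′ = n ∸ w % n
    shift : ∀ m → m + suc (w / n) * n ≡ m + w + w′
    shift m = trans (cong (m +_) (sym (m+[n∸m%n]≡[1+m/n]*n w n))) (sym (+-assoc m w w′))

  *-cancelˡ-coprime : ∀ {k x z} → Coprime n k → k * x ≈ k * z → x ≈ z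
  *-cancelˡ-coprime {k} {x} {z} n⊥k kx≈kz = begin
    x     ≈⟨ m%n≈m x ⟨
    x % n ≡⟨ residues-equal (≤-total (x % n) (z % n)) ⟩
    z % n ≈⟨ m%n≈m z ⟩
    z     ∎
    where
    open ≈-Reasoning
    kx%≈kz% : k * (x % n) ≈ k * (z % n)
    kx%≈kz% = begin
      k * (x % n) ≈⟨ *-congˡ k (m%n≈m x) ⟩
      k * x       ≈⟨ kx≈kz ⟩
      k * z       ≈⟨ *-congˡ k (m%n≈m z) ⟨
      k * (z % n) ∎
    cancel-ordered : ∀ {u v} → u ≤ v → v < n → k * u ≈ k * v → u ≡ v
    cancel-ordered {u} {v} u≤v v<n ku≈kv with v ∸ u | m+[n∸m]≡n u≤v
    ... | δ | refl = sym (trans (cong (u +_) δ≡0) (+-identityʳ u))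
      where
      kδ≈0 : k * δ + k * u ≈ 0 + k * u
      kδ≈0 = begin
        k * δ + k * u ≡⟨ +-comm (k * δ) (k * u) ⟩
        k * u + k * δ ≡⟨ *-distribˡ-+ k u δ ⟨
        k * (u + δ)   ≈⟨ ku≈kv ⟨
        k * u         ∎
      δ≡0 : δ ≡ 0
      δ≡0 = ∣∧<⇒≡0 (coprime-divisor n⊥k (≈0⇒∣ (+-cancelʳ (k * u) kδ≈0)))
                   (≤-<-trans (m≤n+m δ u) v<n)
    residues-equal : x % n ≤ z % n ⊎ z % n ≤ x % n → x % n ≡ z % n
    residues-equal (inj₁ x%≤z%) = cancel-ordered x%≤z% (m%n<n z n) kx%≈kz%
    residues-equal (inj₂ z%≤x%) = sym (cancel-ordered z%≤x% (m%n<n x n) (≈-sym kx%≈kz%))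

-- Residues of multiples of ℓ modulo a

module Residue (a ℓ : ℕ) .{{_ : NonZero a}} where

  open Congruence a

  res : ℕ → ℕ
  res m = (ℓ * m) % a

  res<a : ∀ m → res m < a
  res<a m = m%n<n (ℓ * m) a

  res≈ : ∀ m → res m ≈ ℓ * m
  res≈ m = m%n≈m (ℓ * m)

  module CheapestRepresentation (b c : ℕ) (0<c : 0 < c) (a⊥b : Coprime a b)
                                  (ℓb%a≡c%a : (ℓ * b) % a ≡ c % a) where

    Cheapest : ℕ → Set
    Cheapest k = ∀ m → m ≤ k → c * m ≤ b * res m

    c*n≈b*[ℓ*n] : ∀ n → c * n ≈ b * (ℓ * n)
    c*n≈b*[ℓ*n] n = begin
      c * n       ≡⟨ *-comm c n ⟩
      n * c       ≈⟨ *-congˡ n (mk≈ ℓb%a≡c%a) ⟨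
      n * (ℓ * b) ≡⟨ regroup n ℓ b ⟩
      b * (ℓ * n) ∎
      where
      open ≈-Reasoning
      regroup : ∀ n ℓ b → n * (ℓ * b) ≡ b * (ℓ * n)
      regroup = solve-∀

    ≈b*x⇒0< : ∀ {w x} → 0 < x → x < a → w ≈ b * x → 0 < w
    ≈b*x⇒0< {zero} {x} 0<x x<a 0≈bx = ⊥-elim (<⇒≢ 0<x (sym x≡0))
      where
      x≡0 : x ≡ 0
      x≡0 = ≈∧<⇒≡ x<a (>-nonZero⁻¹ a)
              (*-cancelˡ-coprime a⊥b (≈-trans (≈-sym 0≈bx) (≈-reflexive (sym (*-zeroʳ b)))))
    ≈b*x⇒0< {suc w} _ _ _ = z<s

    c∣𝐦[bx]⇒cheapest : ∀ {x} → 0 < x → x < a →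
                        Σ ℕ (λ v → IsM a b c (b * x) v × c ∣ v) →
                        ∃ λ k → 0 < k × res k ≡ x × Cheapest k
    c∣𝐦[bx]⇒cheapest _ _ (_ , (() , _) , divides zero refl)
    c∣𝐦[bx]⇒cheapest {x} 0<x x<a (_ , (_ , _ , kc≈bx , least) , divides k@(suc _) refl) =
      k , z<s , resk≡x , cheapest
      where
      ℓk≈x : ℓ * k ≈ x
      ℓk≈x = *-cancelˡ-coprime a⊥b (begin
        b * (ℓ * k) ≈⟨ c*n≈b*[ℓ*n] k ⟨
        c * k       ≡⟨ *-comm c k ⟩
        k * c       ≈⟨ mod-≡⇒≈ kc≈bx ⟩
        b * x       ∎)
        where open ≈-Reasoning
      resk≡x : res k ≡ x
      resk≡x = ≈∧<⇒≡ (res<a k) x<a (≈-trans (res≈ k) ℓk≈x)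
      b*res[m]+c*[k∸m]≈b*x : ∀ {m} → m ≤ k → b * res m + c * (k ∸ m) ≈ b * x
      b*res[m]+c*[k∸m]≈b*x {m} m≤k = begin
        b * res m + c * e         ≈⟨ +-cong (*-congˡ b (res≈ m)) (c*n≈b*[ℓ*n] e) ⟩
        b * (ℓ * m) + b * (ℓ * e) ≡⟨ *-distribˡ-+ b (ℓ * m) (ℓ * e) ⟨
        b * (ℓ * m + ℓ * e)       ≡⟨ cong (b *_) (*-distribˡ-+ ℓ m e) ⟨
        b * (ℓ * (m + e))         ≡⟨ cong (λ n → b * (ℓ * n)) (m+[n∸m]≡n m≤k) ⟩
        b * (ℓ * k)               ≈⟨ *-congˡ b ℓk≈x ⟩
        b * x                     ∎
        where
        open ≈-Reasoning
        e = k ∸ m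
      cheapest : Cheapest k
      cheapest m m≤k = +-cancelʳ-≤ (c * e) (c * m) (b * res m) (begin
        c * m + c * e     ≡⟨ *-distribˡ-+ c m e ⟨
        c * (m + e)       ≡⟨ cong (c *_) (m+[n∸m]≡n m≤k) ⟩
        c * k             ≡⟨ *-comm c k ⟩
        k * c             ≤⟨ least _ 0<rival (res m , e , refl) (≈⇒mod-≡ rival≈bx) ⟩
        b * res m + c * e ∎)
        where
        open ≤-Reasoning
        e = k ∸ m
        rival≈bx : b * res m + c * e ≈ b * x
        rival≈bx = b*res[m]+c*[k∸m]≈b*x m≤k
        0<rival : 0 < b * res m + c * e
        0<rival = ≈b*x⇒0< 0<x x<a rival≈bx

    cheapest⇒c∣𝐦[bx] : ∀ {x k} → 0 < k → res k ≡ x → Cheapest k →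
                        Σ ℕ (λ v → IsM a b c (b * x) v × c ∣ v)
    cheapest⇒c∣𝐦[bx] {x} {k} 0<k resk≡x cheapest = c * k , 𝐦[bx]≡c*k , divides k (*-comm c k)
      where
      ℓk≈x : ℓ * k ≈ x
      ℓk≈x = ≈-trans (≈-sym (res≈ k)) (≈-reflexive resk≡x)
      ck≈bx : c * k ≈ b * x
      ck≈bx = ≈-trans (c*n≈b*[ℓ*n] k) (*-congˡ b ℓk≈x)
      least : ∀ w → 0 < w → Repr b c w → w mod a ≡ (b * x) mod a → c * k ≤ w
      least _ _ (n₁ , n₂ , refl) w≈bx with ≤-total k n₂
      ... | inj₁ k≤n₂ = ≤-trans (*-monoʳ-≤ c k≤n₂) (m≤n+m (c * n₂) (b * n₁))
      ... | inj₂ n₂≤k = c*k≤w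
        where
        m = k ∸ n₂
        k≡m+n₂ : k ≡ m + n₂
        k≡m+n₂ = sym (m∸n+n≡m n₂≤k)
        n₁≈ℓm : n₁ ≈ ℓ * m
        n₁≈ℓm = *-cancelˡ-coprime a⊥b (+-cancelʳ (c * n₂) (begin
          b * n₁ + c * n₂           ≈⟨ mod-≡⇒≈ w≈bx ⟩
          b * x                     ≈⟨ ck≈bx ⟨
          c * k                     ≡⟨ cong (c *_) k≡m+n₂ ⟩
          c * (m + n₂)              ≡⟨ *-distribˡ-+ c m n₂ ⟩
          c * m + c * n₂            ≈⟨ +-cong (c*n≈b*[ℓ*n] m) ≈-refl ⟩
          b * (ℓ * m) + c * n₂      ∎))
          where open ≈-Reasoning
        resm≤n₁ : res m ≤ n₁
        resm≤n₁ = subst (_≤ n₁) (≈⇒%≡% n₁≈ℓm) (m%n≤m n₁ a)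
        c*k≤w : c * k ≤ b * n₁ + c * n₂
        c*k≤w = begin
          c * k                 ≡⟨ cong (c *_) k≡m+n₂ ⟩
          c * (m + n₂)          ≡⟨ *-distribˡ-+ c m n₂ ⟩
          c * m + c * n₂        ≤⟨ +-monoˡ-≤ (c * n₂) (cheapest m (m∸n≤m k n₂)) ⟩
          b * res m + c * n₂    ≤⟨ +-monoˡ-≤ (c * n₂) (*-monoʳ-≤ b resm≤n₁) ⟩
          b * n₁ + c * n₂       ∎
          where open ≤-Reasoning
      𝐦[bx]≡c*k : IsM a b c (b * x) (c * k)
      𝐦[bx]≡c*k = *-mono-< 0<c 0<k , (0 , k , sym (cong (_+ c * k) (*-zeroʳ b))) ,
                  ≈⇒mod-≡ ck≈bx , least

  module Decomposition (ℓ<a : ℓ < a) where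

    d q r s : ℕ
    d = a ∸ ℓ
    q = a div d
    r = a ∸ q * d
    s = d ∸ r

    instance
      d≢0 : NonZero d
      d≢0 = >-nonZero (m<n⇒0<n∸m ℓ<a)

    ℓ+d≡a : ℓ + d ≡ a
    ℓ+d≡a = m+[n∸m]≡n (<⇒≤ ℓ<a)

    q*d+r≡a : q * d + r ≡ a
    q*d+r≡a = m+[n∸m]≡n (m-div-n*n≤m a d)

    r<d : r < d
    r<d = +-cancelʳ-< (q * d) r d (begin-strict
      r + q * d ≡⟨ +-comm r (q * d) ⟩
      q * d + r ≡⟨ q*d+r≡a ⟩
      a         <⟨ m<[1+m-div-n]*n a d ⟩
      d + q * d ∎)
      where open ≤-Reasoning

    s+r≡d : s + r ≡ d
    s+r≡d = m∸n+n≡m (<⇒≤ r<d)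

    0<s : 0 < s
    0<s = m<n⇒0<n∸m r<d

    instance
      s≢0 : NonZero s
      s≢0 = >-nonZero 0<s

    0<q : 0 < q
    0<q = n*o≤m⇒n≤m-div-o d (subst (_≤ a) (sym (*-identityˡ d)) (m∸n≤m a ℓ))

    r<a : r < a
    r<a = <-≤-trans r<d (m∸n≤m a ℓ)

    a≡q*[s+r]+r : a ≡ q * (s + r) + r
    a≡q*[s+r]+r = trans (sym q*d+r≡a) (cong (λ n → q * n + r) (sym s+r≡d))

    coprime-r-s : Coprime a ℓ → Coprime r s
    coprime-r-s a⊥ℓ {p} (p∣r , p∣s) = a⊥ℓ (p∣a , p∣ℓ)
      where
      p∣d : p ∣ d
      p∣d = subst (p ∣_) s+r≡d (∣m∣n⇒∣m+n p∣s p∣r)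
      p∣a : p ∣ a
      p∣a = subst (p ∣_) q*d+r≡a (∣m∣n⇒∣m+n (∣n⇒∣m*n q p∣d) p∣r)
      p∣ℓ : p ∣ ℓ
      p∣ℓ = ∣m+n∣m⇒∣n (subst (p ∣_) (trans (sym ℓ+d≡a) (+-comm ℓ d)) p∣a) p∣d

    ℓ*q≈r : ℓ * q ≈ r
    ℓ*q≈r = begin
      ℓ * q             ≈⟨ m+kn≈m (ℓ * q) 1 ⟨
      ℓ * q + 1 * a     ≡⟨ cong (ℓ * q +_) (+-identityʳ a) ⟩
      ℓ * q + a         ≡⟨ cong (ℓ * q +_) q*d+r≡a ⟨
      ℓ * q + (q * d + r) ≡⟨ regroup ℓ q d r ⟩
      r + q * (ℓ + d)   ≡⟨ cong (λ n → r + q * n) ℓ+d≡a ⟩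
      r + q * a         ≈⟨ m+kn≈m r q ⟩
      r                 ∎
      where
      open ≈-Reasoning
      regroup : ∀ ℓ q d r → ℓ * q + (q * d + r) ≡ r + q * (ℓ + d)
      regroup = solve-∀

    ℓ*[1+q]+s≈0 : ℓ * suc q + s ≈ 0
    ℓ*[1+q]+s≈0 = begin
      ℓ * suc q + s     ≡⟨ regroup ℓ q s ⟩
      ℓ * q + (ℓ + s)   ≈⟨ +-cong ℓ*q≈r ≈-refl ⟩
      r + (ℓ + s)       ≡⟨ regroup′ r ℓ s ⟩
      ℓ + (s + r)       ≡⟨ cong (ℓ +_) s+r≡d ⟩
      ℓ + d             ≡⟨ ℓ+d≡a ⟩
      a                 ≈⟨ n≈0 ⟩
      0                 ∎
      where
      open ≈-Reasoning
      regroup : ∀ ℓ q s → ℓ * suc q + s ≡ ℓ * q + (ℓ + s)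
      regroup = solve-∀
      regroup′ : ∀ r ℓ s → r + (ℓ + s) ≡ ℓ + (s + r)
      regroup′ = solve-∀

    Y+ts≡ri⇒res[qi+[1+q]t]≡Y : ∀ {i t Y} → Y + t * s ≡ r * i → Y < a →
                               res (q * i + suc q * t) ≡ Y
    Y+ts≡ri⇒res[qi+[1+q]t]≡Y {i} {t} {Y} Y+ts≡ri Y<a =
      ≈∧<⇒≡ (res<a m) Y<a (≈-trans (res≈ m) (+-cancelʳ (t * s) (begin
        ℓ * m + t * s                          ≡⟨ regroup ℓ q i t s ⟩
        i * (ℓ * q) + t * (ℓ * suc q + s)      ≈⟨ +-cong (*-congˡ i ℓ*q≈r) (*-congˡ t ℓ*[1+q]+s≈0) ⟩
        i * r + t * 0                          ≡⟨ cong₂ _+_ (*-comm i r) (*-zeroʳ t) ⟩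
        r * i + 0                              ≡⟨ +-identityʳ (r * i) ⟩
        r * i                                  ≡⟨ Y+ts≡ri ⟨
        Y + t * s                              ∎)))
      where
      open ≈-Reasoning
      m = q * i + suc q * t
      regroup : ∀ ℓ q i t s → ℓ * (q * i + suc q * t) + t * s
                              ≡ i * (ℓ * q) + t * (ℓ * suc q + s)
      regroup = solve-∀

    d*m+res[m]≡J*a : ∀ {m} → 0 < m → ∃ λ J → 0 < J × d * m + res m ≡ J * a
    d*m+res[m]≡J*a {m} 0<m with ≈0⇒∣ d*m+res[m]≈0
      where
      d*m+res[m]≈0 : d * m + res m ≈ 0
      d*m+res[m]≈0 = begin
        d * m + res m ≈⟨ +-cong ≈-refl (res≈ m) ⟩
        d * m + ℓ * m ≡⟨ *-distribʳ-+ m d ℓ ⟨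
        (d + ℓ) * m   ≡⟨ cong (_* m) (trans (+-comm d ℓ) ℓ+d≡a) ⟩
        a * m         ≡⟨ *-comm a m ⟩
        m * a         ≈⟨ m+kn≈m 0 m ⟩
        0             ∎
        where open ≈-Reasoning
    ... | divides zero dm+res≡0 =
      ⊥-elim (<⇒≢ (*-mono-< (>-nonZero⁻¹ d) 0<m) (sym (m+n≡0⇒m≡0 (d * m) dm+res≡0)))
    ... | divides J@(suc _) dm+res≡Ja = J , z<s , dm+res≡Ja

    d*m+Y≡J*a⇒m≡J*q+t : ∀ {m Y J} → Y ≤ J * r → d * m + Y ≡ J * a →
                        ∃ λ t → m ≡ J * q + t × d * t + Y ≡ J * r
    d*m+Y≡J*a⇒m≡J*q+t {m} {Y} {J} Y≤Jr dm+Y≡Ja = m ∸ J * q , m≡Jq+t , dt+Y≡Jr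
      where
      dm+Y≡d[Jq]+Jr : d * m + Y ≡ d * (J * q) + J * r
      dm+Y≡d[Jq]+Jr = begin
        d * m + Y           ≡⟨ dm+Y≡Ja ⟩
        J * a               ≡⟨ cong (J *_) q*d+r≡a ⟨
        J * (q * d + r)     ≡⟨ regroup J q d r ⟩
        d * (J * q) + J * r ∎
        where
        open ≡-Reasoning
        regroup : ∀ J q d r → J * (q * d + r) ≡ d * (J * q) + J * r
        regroup = solve-∀
      Jq≤m : J * q ≤ m
      Jq≤m = *-cancelˡ-≤ d (+-cancelʳ-≤ Y (d * (J * q)) (d * m) (begin
        d * (J * q) + Y     ≤⟨ +-monoʳ-≤ (d * (J * q)) Y≤Jr ⟩
        d * (J * q) + J * r ≡⟨ dm+Y≡d[Jq]+Jr ⟨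
        d * m + Y           ∎))
        where open ≤-Reasoning
      m≡Jq+t : m ≡ J * q + (m ∸ J * q)
      m≡Jq+t = sym (m+[n∸m]≡n Jq≤m)
      dt+Y≡Jr : d * (m ∸ J * q) + Y ≡ J * r
      dt+Y≡Jr = +-cancelˡ-≡ (d * (J * q)) _ _ (begin
        d * (J * q) + (d * t + Y) ≡⟨ +-assoc (d * (J * q)) (d * t) Y ⟨
        d * (J * q) + d * t + Y   ≡⟨ cong (_+ Y) (*-distribˡ-+ d (J * q) t) ⟨
        d * (J * q + t) + Y       ≡⟨ cong (λ n → d * n + Y) m≡Jq+t ⟨
        d * m + Y                 ≡⟨ dm+Y≡d[Jq]+Jr ⟩
        d * (J * q) + J * r       ∎)
        where
        open ≡-Reasoning
        t = m ∸ J * q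

    d*t+Y≡J*r⇒Y+t*s≡r*i : ∀ {t Y J} .{{_ : NonZero r}} → d * t + Y ≡ J * r →
                          ∃ λ i → J ≡ i + t × Y + t * s ≡ r * i
    d*t+Y≡J*r⇒Y+t*s≡r*i {t} {Y} {J} dt+Y≡Jr = J ∸ t , J≡i+t , Y+ts≡ri
      where
      t≤J : t ≤ J
      t≤J = *-cancelʳ-≤ t J r (begin
        t * r     ≤⟨ *-monoʳ-≤ t (<⇒≤ r<d) ⟩
        t * d     ≡⟨ *-comm t d ⟩
        d * t     ≤⟨ m≤m+n (d * t) Y ⟩
        d * t + Y ≡⟨ dt+Y≡Jr ⟩
        J * r     ∎)
        where open ≤-Reasoning
      J≡i+t : J ≡ J ∸ t + t
      J≡i+t = sym (m∸n+n≡m t≤J)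
      Y+ts≡ri : Y + t * s ≡ r * (J ∸ t)
      Y+ts≡ri = +-cancelʳ-≡ (r * t) _ _ (begin
        Y + t * s + r * t ≡⟨ regroup Y t s r ⟩
        (s + r) * t + Y   ≡⟨ cong (λ n → n * t + Y) s+r≡d ⟩
        d * t + Y         ≡⟨ dt+Y≡Jr ⟩
        J * r             ≡⟨ cong (_* r) J≡i+t ⟩
        (i + t) * r       ≡⟨ regroup′ i t r ⟩
        r * i + r * t     ∎)
        where
        open ≡-Reasoning
        i = J ∸ t
        regroup : ∀ Y t s r → Y + t * s + r * t ≡ (s + r) * t + Y
        regroup = solve-∀
        regroup′ : ∀ i t r → (i + t) * r ≡ r * i + r * t
        regroup′ = solve-∀

    -- Opaque: i and t are built from a quotient whose normal form is enormous, and letting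
    -- them unfold where the decomposition is used exhausts memory during type checking.
    opaque
      res≤r⇒decomposition : .{{_ : NonZero r}} → ∀ {m} → 0 < m → res m ≤ r →
                            ∃₂ λ i t → m ≡ q * i + suc q * t × res m + t * s ≡ r * i
      res≤r⇒decomposition {m} 0<m res≤r with d*m+res[m]≡J*a 0<m
      ... | J , 0<J , dm+Y≡Ja
          with d*m+Y≡J*a⇒m≡J*q+t {m} {res m} {J} (≤-trans res≤r (m≤n*m r J {{>-nonZero 0<J}})) dm+Y≡Ja
      ... | t , m≡Jq+t , dt+Y≡Jr with d*t+Y≡J*r⇒Y+t*s≡r*i {t} {res m} {J} dt+Y≡Jr
      ... | i , J≡i+t , Y+ts≡ri = i , t , m≡qi+[1+q]t , Y+ts≡ri
        where
        m≡qi+[1+q]t : m ≡ q * i + suc q * t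
        m≡qi+[1+q]t = begin
          m                 ≡⟨ m≡Jq+t ⟩
          J * q + t         ≡⟨ cong (λ n → n * q + t) J≡i+t ⟩
          (i + t) * q + t   ≡⟨ regroup i t q ⟩
          q * i + suc q * t ∎
          where
          open ≡-Reasoning
          regroup : ∀ i t q → (i + t) * q + t ≡ q * i + suc q * t
          regroup = solve-∀

    res[m∸q]+r≡res[m] : ∀ {m} → q ≤ m → r ≤ res m → res (m ∸ q) + r ≡ res m
    res[m∸q]+r≡res[m] {m} q≤m r≤res = trans (cong (_+ r) res[m∸q]≡res[m]∸r) (m∸n+n≡m r≤res)
      where
      res[m∸q]≡res[m]∸r : res (m ∸ q) ≡ res m ∸ r
      res[m∸q]≡res[m]∸r = ≈∧<⇒≡ (res<a (m ∸ q)) (≤-<-trans (m∸n≤m (res m) r) (res<a m))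
        (+-cancelʳ r (begin
          res (m ∸ q) + r         ≈⟨ +-cong (res≈ (m ∸ q)) (≈-sym ℓ*q≈r) ⟩
          ℓ * (m ∸ q) + ℓ * q     ≡⟨ *-distribˡ-+ ℓ (m ∸ q) q ⟨
          ℓ * (m ∸ q + q)         ≡⟨ cong (ℓ *_) (m∸n+n≡m q≤m) ⟩
          ℓ * m                   ≈⟨ res≈ m ⟨
          res m                   ≡⟨ m∸n+n≡m r≤res ⟨
          res m ∸ r + r           ∎))
        where open ≈-Reasoning

    t<r⇒0<res[m] : ∀ {m i t} → Coprime a ℓ → 0 < m → t < r →
                   m ≡ q * i + suc q * t → res m + t * s ≡ r * i → 0 < res m
    t<r⇒0<res[m] {m} {i} {t} a⊥ℓ 0<m t<r m≡ res+ts≡ri =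
      n≢0⇒n>0 λ res≡0 → <⇒≢ 0<m (sym (m≡0 res≡0))
      where
      m≡0 : res m ≡ 0 → m ≡ 0
      m≡0 res≡0 = begin
        m                   ≡⟨ m≡ ⟩
        q * i + suc q * t   ≡⟨ cong₂ (λ i t → q * i + suc q * t) i≡0 t≡0 ⟩
        q * 0 + suc q * 0   ≡⟨ cong₂ _+_ (*-zeroʳ q) (*-zeroʳ (suc q)) ⟩
        0                   ∎
        where
        open ≡-Reasoning
        st≡ir : s * t ≡ i * r
        st≡ir = begin
          s * t         ≡⟨ *-comm s t ⟩
          t * s         ≡⟨ cong (_+ t * s) res≡0 ⟨
          res m + t * s ≡⟨ res+ts≡ri ⟩
          r * i         ≡⟨ *-comm r i ⟩
          i * r         ∎
        t≡0 : t ≡ 0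
        t≡0 = ∣∧<⇒≡0 (coprime-divisor (coprime-r-s a⊥ℓ) (divides i st≡ir)) t<r
        i≡0 : i ≡ 0
        i≡0 = m*n≡0⇒m≡0 i r {{>-nonZero (≤-<-trans z≤n t<r)}}
                (trans (sym st≡ir) (trans (cong (s *_) t≡0) (*-zeroʳ s)))

-- The set 𝒳

reindex : ∀ {P : ℕ → Set} {f g : ℕ → ℕ} {μ ν} → μ ≡ ν → (∀ t → t ≤ μ → f t ≡ g t) →
          (∀ x → P x ⇔ (∃ λ t → t ≤ μ × x ≡ f t)) →
          ∀ x → P x ⇔ (∃ λ t → t ≤ ν × x ≡ g t)
reindex refl f≗g P⇔ x = mk⇔
  (λ Px → let t , t≤μ , x≡ft = Equivalence.to (P⇔ x) Px
          in  t , t≤μ , trans x≡ft (f≗g t t≤μ))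
  (λ (t , t≤μ , x≡gt) → Equivalence.from (P⇔ x) (t , t≤μ , trans x≡gt (sym (f≗g t t≤μ))))

module Setting (a b c ℓ : ℕ) .{{_ : NonZero a}}
  (ℓ<a : ℓ < a) (a<b : a < b) (b<c : b < c)
  (a⊥b : Coprime a b) (b⊥c : Coprime b c) (a⊥c : Coprime a c)
  (ℓb%a≡c%a : (ℓ * b) % a ≡ c % a) where

  open Congruence a
  open Residue a ℓ
  open Decomposition ℓ<a

  0<c : 0 < c
  0<c = <-trans (≤-<-trans z≤n a<b) b<c

  open CheapestRepresentation b c 0<c a⊥b ℓb%a≡c%a

  a⊥ℓ : Coprime a ℓ
  a⊥ℓ {p} (p∣a , p∣ℓ) = a⊥c (p∣a , p∣c)
    where
    p∣c : p ∣ c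
    p∣c = ∣n∣m%n⇒∣m p∣a (subst (p ∣_) ℓb%a≡c%a (%-presˡ-∣ (∣m⇒∣m*n b p∣ℓ) p∣a))

  r<c : r < c
  r<c = <-trans r<a (<-trans a<b b<c)

  A B : ℕ
  A = b * r ∸ c * q
  B = b * s + c * suc q

  module _ (cq<br : c * q < b * r) where

    0<r : 0 < r
    0<r = n≢0⇒n>0 λ r≡0 → <⇒≱ cq<br (begin
      b * r ≡⟨ cong (b *_) r≡0 ⟩
      b * 0 ≡⟨ *-zeroʳ b ⟩
      0     ≤⟨ z≤n ⟩
      c * q ∎)
      where open ≤-Reasoning

    0<A : 0 < A
    0<A = m<n⇒0<n∸m cq<br

    0<B : 0 < B
    0<B = ≤-trans (*-mono-< 0<c (z<s {q})) (m≤n+m (c * suc q) (b * s))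

    instance
      r≢0 : NonZero r
      r≢0 = >-nonZero 0<r
      A≢0 : NonZero A
      A≢0 = >-nonZero 0<A
      B≢0 : NonZero B
      B≢0 = >-nonZero 0<B

    A+cq≡br : A + c * q ≡ b * r
    A+cq≡br = m∸n+n≡m (<⇒≤ cq<br)

    tB+bY≡iA+c[qi+[1+q]t] : ∀ {i t Y} → Y + t * s ≡ r * i →
                             t * B + b * Y ≡ i * A + c * (q * i + suc q * t)
    tB+bY≡iA+c[qi+[1+q]t] {i} {t} {Y} Y+ts≡ri = +-cancelʳ-≡ (i * (c * q)) _ _ (begin
      t * B + b * Y + i * (c * q)    ≡⟨ regroup t b s c q Y i ⟩
      b * (Y + t * s) + c * m        ≡⟨ cong (λ n → b * n + c * m) Y+ts≡ri ⟩
      b * (r * i) + c * m            ≡⟨ cong (_+ c * m) (regroup′ b r i) ⟩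
      i * (b * r) + c * m            ≡⟨ cong (λ n → i * n + c * m) A+cq≡br ⟨
      i * (A + c * q) + c * m        ≡⟨ regroup″ i A c q m ⟩
      i * A + c * m + i * (c * q)    ∎)
      where
      open ≡-Reasoning
      m = q * i + suc q * t
      regroup : ∀ t b s c q Y i → t * (b * s + c * suc q) + b * Y + i * (c * q)
                                  ≡ b * (Y + t * s) + c * (q * i + suc q * t)
      regroup = solve-∀
      regroup′ : ∀ b r i → b * (r * i) ≡ i * (b * r)
      regroup′ = solve-∀
      regroup″ : ∀ i A c q m → i * (A + c * q) + c * m ≡ i * A + c * m + i * (c * q)
      regroup″ = solve-∀

    c*k≤b*Y⇔t*B≤i*A : ∀ {i t Y} → Y + t * s ≡ r * i →
                       c * (q * i + suc q * t) ≤ b * Y ⇔ t * B ≤ i * A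
    c*k≤b*Y⇔t*B≤i*A {i} {t} {Y} Y+ts≡ri = mk⇔
      (λ ck≤bY → +-cancelʳ-≤ (b * Y) (t * B) (i * A) (begin
        t * B + b * Y ≡⟨ identity ⟩
        i * A + c * k ≤⟨ +-monoʳ-≤ (i * A) ck≤bY ⟩
        i * A + b * Y ∎))
      (λ tB≤iA → +-cancelˡ-≤ (i * A) (c * k) (b * Y) (begin
        i * A + c * k ≡⟨ identity ⟨
        t * B + b * Y ≤⟨ +-monoˡ-≤ (b * Y) tB≤iA ⟩
        i * A + b * Y ∎))
      where
      open ≤-Reasoning
      k = q * i + suc q * t
      identity : t * B + b * Y ≡ i * A + c * k
      identity = tB+bY≡iA+c[qi+[1+q]t] Y+ts≡ri

    r*B≡s*A+c*a : r * B ≡ s * A + c * a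
    r*B≡s*A+c*a = +-cancelʳ-≡ (c * q * s) _ _ (begin
      r * B + c * q * s                 ≡⟨ regroup r b s c q ⟩
      b * r * s + c * (q * (s + r) + r) ≡⟨ cong₂ (λ m n → m * s + c * n) A+cq≡br a≡q*[s+r]+r ⟨
      (A + c * q) * s + c * a           ≡⟨ regroup′ A c q s a ⟩
      s * A + c * a + c * q * s         ∎)
      where
      open ≡-Reasoning
      regroup : ∀ r b s c q → r * (b * s + c * suc q) + c * q * s
                              ≡ b * r * s + c * (q * (s + r) + r)
      regroup = solve-∀
      regroup′ : ∀ A c q s a → (A + c * q) * s + c * a ≡ s * A + c * a + c * q * s
      regroup′ = solve-∀

    [1+s]*A≤r*B : suc s * A ≤ r * B
    [1+s]*A≤r*B = begin
      A + s * A     ≡⟨ +-comm A (s * A) ⟩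
      s * A + A     ≤⟨ +-monoʳ-≤ (s * A) A≤c*a ⟩
      s * A + c * a ≡⟨ r*B≡s*A+c*a ⟨
      r * B         ∎
      where
      open ≤-Reasoning
      A≤c*a : A ≤ c * a
      A≤c*a = ≤-trans (m∸n≤m (b * r) (c * q)) (*-mono-≤ (<⇒≤ b<c) (<⇒≤ r<a))

    ⌊st/r⌋≤⌊tB/A⌋ : ∀ t → (s * t) div r ≤ (t * B) div A
    ⌊st/r⌋≤⌊tB/A⌋ t = n*o≤m⇒n≤m-div-o A (*-cancelʳ-≤ (f * A) (t * B) r (begin
      f * A * r     ≡⟨ regroup f A r ⟩
      f * r * A     ≤⟨ *-monoˡ-≤ A (m-div-n*n≤m (s * t) r) ⟩
      s * t * A     ≡⟨ regroup′ s t A ⟩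
      t * (s * A)   ≤⟨ *-monoʳ-≤ t (≤-trans (m≤n+m (s * A) A) [1+s]*A≤r*B) ⟩
      t * (r * B)   ≡⟨ regroup″ t r B ⟩
      t * B * r     ∎))
      where
      open ≤-Reasoning
      f = (s * t) div r
      regroup : ∀ x y z → x * y * z ≡ x * z * y
      regroup = solve-∀
      regroup′ : ∀ x y z → x * y * z ≡ y * (x * z)
      regroup′ = solve-∀
      regroup″ : ∀ x y z → x * (y * z) ≡ x * z * y
      regroup″ = solve-∀

    X+Ts≡rI⇒T*B≢I*A : ∀ {T I X} → 0 < X → X ≤ r → X + T * s ≡ r * I → T * B ≢ I * A
    X+Ts≡rI⇒T*B≢I*A {T} {I} {X} 0<X X≤r X+Ts≡rI TB≡IA = <⇒≱ (≤-<-trans X≤r r<c) (∣⇒≤ c∣X)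
      where
      instance
        X≢0 : NonZero X
        X≢0 = >-nonZero 0<X
      k = q * I + suc q * T
      bX≡k*c : b * X ≡ k * c
      bX≡k*c = +-cancelˡ-≡ (T * B) _ _ (begin
        T * B + b * X ≡⟨ tB+bY≡iA+c[qi+[1+q]t] {I} {T} X+Ts≡rI ⟩
        I * A + c * k ≡⟨ cong (_+ c * k) TB≡IA ⟨
        T * B + c * k ≡⟨ cong (T * B +_) (*-comm c k) ⟩
        T * B + k * c ∎)
        where open ≡-Reasoning
      c∣X : c ∣ X
      c∣X = coprime-divisor (Coprimality.sym b⊥c) (divides k bX≡k*c)

    T*s<r⇒T*B≢A : ∀ {T} → T * s < r → T * B ≢ A
    T*s<r⇒T*B≢A {T} Ts<r TB≡A = X+Ts≡rI⇒T*B≢I*A {T} {1} (m<n⇒0<n∸m Ts<r) (m∸n≤m r (T * s))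
      (trans (m∸n+n≡m (<⇒≤ Ts<r)) (sym (*-identityʳ r))) (trans TB≡A (sym (*-identityˡ A)))

    ⌊s/r⌋<⌊B/A⌋⇒A<B : s div r < B div A → A < B
    ⌊s/r⌋<⌊B/A⌋⇒A<B ⌊s/r⌋<⌊B/A⌋ = ≤∧≢⇒< A≤B A≢B
      where
      A≤B : A ≤ B
      A≤B = ≮⇒≥ λ B<A → n≮0 (subst (s div r <_) (m<n⇒m-div-n≡0 A B<A) ⌊s/r⌋<⌊B/A⌋)
      A≢B : A ≢ B
      A≢B A≡B = T*s<r⇒T*B≢A {1} (subst (_< r) (sym (*-identityˡ s)) s<r)
                                   (trans (*-identityˡ B) (sym A≡B))
        where
        ⌊B/A⌋≡1 : B div A ≡ 1
        ⌊B/A⌋≡1 = trans (cong (B div_) A≡B) (n-div-n≡1 B)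
        ⌊s/r⌋≡0 : s div r ≡ 0
        ⌊s/r⌋≡0 = n<1⇒n≡0 (subst (s div r <_) ⌊B/A⌋≡1 ⌊s/r⌋<⌊B/A⌋)
        s<r : s < r
        s<r = subst (s <_) (+-identityʳ r)
                (subst (λ n → s < suc n * r) ⌊s/r⌋≡0 (m<[1+m-div-n]*n s r))

    x[_] k[_] : ℕ → ℕ
    x[ t ] = r * suc ((s * t) div r) ∸ s * t
    k[ t ] = q * suc ((s * t) div r) + suc q * t

    s*t<r*[1+⌊st/r⌋] : ∀ t → s * t < r * suc ((s * t) div r)
    s*t<r*[1+⌊st/r⌋] t =
      subst (s * t <_) (*-comm (suc ((s * t) div r)) r) (m<[1+m-div-n]*n (s * t) r)

    x[t]+t*s≡r*[1+⌊st/r⌋] : ∀ t → x[ t ] + t * s ≡ r * suc ((s * t) div r)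
    x[t]+t*s≡r*[1+⌊st/r⌋] t =
      trans (cong (x[ t ] +_) (*-comm t s)) (m∸n+n≡m (<⇒≤ (s*t<r*[1+⌊st/r⌋] t)))

    0<x[t] : ∀ t → 0 < x[ t ]
    0<x[t] t = m<n⇒0<n∸m (s*t<r*[1+⌊st/r⌋] t)

    x[t]≤r : ∀ t → x[ t ] ≤ r
    x[t]≤r t = +-cancelʳ-≤ (s * t) x[ t ] r (begin
      x[ t ] + s * t             ≡⟨ m∸n+n≡m (<⇒≤ (s*t<r*[1+⌊st/r⌋] t)) ⟩
      r * suc ((s * t) div r)    ≡⟨ *-suc r _ ⟩
      r + r * ((s * t) div r)    ≤⟨ +-monoʳ-≤ r (subst (_≤ s * t) (*-comm _ r) (m-div-n*n≤m (s * t) r)) ⟩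
      r + s * t                  ∎)
      where open ≤-Reasoning

    0<k[t] : ∀ t → 0 < k[ t ]
    0<k[t] t = ≤-trans (*-mono-< 0<q (z<s {(s * t) div r})) (m≤m+n _ (suc q * t))

    res[k[t]]≡x[t] : ∀ t → res k[ t ] ≡ x[ t ]
    res[k[t]]≡x[t] t =
      Y+ts≡ri⇒res[qi+[1+q]t]≡Y (x[t]+t*s≡r*[1+⌊st/r⌋] t) (≤-<-trans (x[t]≤r t) r<a)

    ⌊st/r⌋<i : ∀ {t i} → s * t < r * i → (s * t) div r < i
    ⌊st/r⌋<i {t} {i} st<ri = m<n*o⇒m-div-o<n r (subst (s * t <_) (*-comm r i) st<ri)

    k[t]≤q*i+[1+q]*t : ∀ {t i} → s * t < r * i → k[ t ] ≤ q * i + suc q * t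
    k[t]≤q*i+[1+q]*t st<ri = +-monoˡ-≤ _ (*-monoʳ-≤ q (⌊st/r⌋<i st<ri))

    m≤k[t]⇒t′≤t : ∀ {t m i t′ Y} → m ≤ k[ t ] → m ≡ q * i + suc q * t′ →
                  Y + t′ * s ≡ r * i → t′ ≤ t
    m≤k[t]⇒t′≤t {t} {m} {i} {t′} {Y} m≤k[t] m≡ Y+t′s≡ri =
      ≮⇒≥ λ t<t′ → <⇒≱ (begin-strict
      k[ t ]              ≤⟨ k[t]≤q*i+[1+q]*t (begin-strict
                               s * t           <⟨ *-monoʳ-< s t<t′ ⟩
                               s * t′          ≡⟨ *-comm s t′ ⟩
                               t′ * s          ≤⟨ m≤n+m (t′ * s) Y ⟩
                               Y + t′ * s      ≡⟨ Y+t′s≡ri ⟩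
                               r * i           ∎) ⟩
      q * i + suc q * t   <⟨ +-monoʳ-< (q * i) (*-monoʳ-< (suc q) t<t′) ⟩
      q * i + suc q * t′  ≡⟨ m≡ ⟨
      m                   ∎) m≤k[t]
      where open ≤-Reasoning

    x[t]≡r∸u*t : ∀ {t u h} → s ≡ u + h * r → u * t < r → x[ t ] ≡ r ∸ u * t
    x[t]≡r∸u*t {t} {u} {h} s≡u+hr ut<r = begin
      r * suc ((s * t) div r) ∸ s * t ≡⟨ cong₂ (λ m n → r * suc m ∸ n) ⌊st/r⌋≡ht st≡ut+htr ⟩
      r * suc (h * t) ∸ (u * t + h * t * r) ≡⟨ cong₂ _∸_ (regroup r h t) (+-comm (u * t) _) ⟩
      h * t * r + r ∸ (h * t * r + u * t) ≡⟨ [m+n]∸[m+o]≡n∸o (h * t * r) r (u * t) ⟩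
      r ∸ u * t                         ∎
      where
      open ≡-Reasoning
      regroup : ∀ r h t → r * suc (h * t) ≡ h * t * r + r
      regroup = solve-∀
      st≡ut+htr : s * t ≡ u * t + h * t * r
      st≡ut+htr = trans (cong (_* t) s≡u+hr) (regroup′ u h r t)
        where
        regroup′ : ∀ u h r t → (u + h * r) * t ≡ u * t + h * t * r
        regroup′ = solve-∀
      ⌊st/r⌋≡ht : (s * t) div r ≡ h * t
      ⌊st/r⌋≡ht = div-unique r (subst (h * t * r ≤_) (sym st≡ut+htr) (m≤n+m (h * t * r) (u * t)))
                             (subst (_< suc (h * t) * r) (sym st≡ut+htr) (+-monoˡ-< (h * t * r) ut<r))

    x[t]≡r∸s*t : ∀ {t} → s * t < r → x[ t ] ≡ r ∸ s * t
    x[t]≡r∸s*t = x[t]≡r∸u*t {h = 0} (sym (+-identityʳ s))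

    s≡d-mod-r+[s-div-r]*r : s ≡ d mod r + s div r * r
    s≡d-mod-r+[s-div-r]*r = begin
      s                           ≡⟨ m≡m-mod-n+[m-div-n]*n s r ⟩
      s mod r + s div r * r       ≡⟨ cong (_+ s div r * r) ([m+n]-mod-n≡m-mod-n s r) ⟨
      (s + r) mod r + s div r * r ≡⟨ cong (λ n → n mod r + s div r * r) s+r≡d ⟩
      d mod r + s div r * r       ∎
      where open ≡-Reasoning

    module Enumeration (μ : ℕ)
      (differ-at-μ : (suc μ * B) div A ≢ (suc μ * s) div r)
      (agree-below-μ : ∀ i → i < μ → (suc i * B) div A ≡ (suc i * s) div r) where

      μ<r : μ < r
      μ<r = ≰⇒> λ r≤μ → n≮n s (begin-strict
        s                            <⟨ n*o≤m⇒n≤m-div-o A [1+s]*A≤r*B ⟩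
        (r * B) div A                ≡⟨ cong (λ n → (n * B) div A) (suc-pred r) ⟨
        (suc (pred r) * B) div A     ≡⟨ agree-below-μ (pred r) (≤-trans (≤-reflexive (suc-pred r)) r≤μ) ⟩
        (suc (pred r) * s) div r     ≡⟨ cong (λ n → (n * s) div r) (suc-pred r) ⟩
        (r * s) div r                ≡⟨ cong (_div r) (*-comm r s) ⟩
        (s * r) div r                ≡⟨ m*n-div-n≡m s r ⟩
        s                            ∎)
        where open ≤-Reasoning

      [1+j]*B<[1+⌊s[1+j]/r⌋]*A : ∀ {j} → j < μ → suc j * B < suc ((s * suc j) div r) * A
      [1+j]*B<[1+⌊s[1+j]/r⌋]*A {j} j<μ =
        subst (λ n → suc j * B < suc n * A)
              (trans (agree-below-μ j j<μ) (cong (_div r) (*-comm (suc j) s)))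
              (m<[1+m-div-n]*n (suc j * B) A)

      t*B≤[1+⌊st/r⌋]*A : ∀ {t} → t ≤ μ → t * B ≤ suc ((s * t) div r) * A
      t*B≤[1+⌊st/r⌋]*A {zero}  _     = z≤n
      t*B≤[1+⌊st/r⌋]*A {suc j} 1+j≤μ = <⇒≤ ([1+j]*B<[1+⌊s[1+j]/r⌋]*A 1+j≤μ)

      res<r⇒c*M≤b*res[M] : ∀ {t M} → t ≤ μ → 0 < M → M ≤ k[ t ] → res M < r →
                           c * M ≤ b * res M
      res<r⇒c*M≤b*res[M] {t} {M} t≤μ 0<M M≤k[t] res<r
          with res≤r⇒decomposition 0<M (<⇒≤ res<r)
      ... | i , t′ , M≡ , Y+t′s≡ri =
        subst (λ n → c * n ≤ b * res M) (sym M≡)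
              (Equivalence.from (c*k≤b*Y⇔t*B≤i*A Y+t′s≡ri) t′B≤iA)
        where
        t′≤μ : t′ ≤ μ
        t′≤μ = ≤-trans (m≤k[t]⇒t′≤t M≤k[t] M≡ Y+t′s≡ri) t≤μ
        i≡1+⌊st′/r⌋ : i ≡ suc ((s * t′) div r)
        i≡1+⌊st′/r⌋ = Y+ts≡ri⇒i≡1+⌊st/r⌋ {t = t′} {s = s}
          (t<r⇒0<res[m] a⊥ℓ 0<M (≤-<-trans t′≤μ μ<r) M≡ Y+t′s≡ri) (<⇒≤ res<r) Y+t′s≡ri
        t′B≤iA : t′ * B ≤ i * A
        t′B≤iA = subst (λ n → t′ * B ≤ n * A) (sym i≡1+⌊st′/r⌋) (t*B≤[1+⌊st/r⌋]*A t′≤μ)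

      cheapest-k[t] : ∀ {t} → t ≤ μ → Cheapest k[ t ]
      cheapest-k[t] {t} t≤μ m m≤k = <-rec P step m m≤k
        where
        P : ℕ → Set
        P M = M ≤ k[ t ] → c * M ≤ b * res M
        step : ∀ M → (∀ {M′} → M′ < M → P M′) → P M
        step zero    _  _ = ≤-trans (≤-reflexive (*-zeroʳ c)) z≤n
        step M@(suc _) rec M≤k with r ≤? res M
        ... | no  r≰res = res<r⇒c*M≤b*res[M] t≤μ z<s M≤k (≰⇒> r≰res)
        ... | yes r≤res with q ≤? M
        ...   | no  q≰M = begin
          c * M     ≤⟨ *-monoʳ-≤ c (<⇒≤ (≰⇒> q≰M)) ⟩
          c * q     ≤⟨ <⇒≤ cq<br ⟩
          b * r     ≤⟨ *-monoʳ-≤ b r≤res ⟩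
          b * res M ∎
          where open ≤-Reasoning
        ...   | yes q≤M = begin
          c * M                       ≡⟨ cong (c *_) (m∸n+n≡m q≤M) ⟨
          c * (M ∸ q + q)             ≡⟨ *-distribˡ-+ c (M ∸ q) q ⟩
          c * (M ∸ q) + c * q         ≤⟨ +-mono-≤ (rec M∸q<M M∸q≤k) (<⇒≤ cq<br) ⟩
          b * res (M ∸ q) + b * r     ≡⟨ *-distribˡ-+ b (res (M ∸ q)) r ⟨
          b * (res (M ∸ q) + r)       ≡⟨ cong (b *_) (res[m∸q]+r≡res[m] q≤M r≤res) ⟩
          b * res M                   ∎
          where
          open ≤-Reasoning
          M∸q<M : M ∸ q < M
          M∸q<M = ∸-monoʳ-< 0<q q≤M
          M∸q≤k : M ∸ q ≤ k[ t ]
          M∸q≤k = ≤-trans (m∸n≤m M q) M≤k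

      x[t]∈𝒳 : ∀ {t} → t ≤ μ → InX a b c r x[ t ]
      x[t]∈𝒳 {t} t≤μ = 0<x[t] t , x[t]≤r t ,
        cheapest⇒c∣𝐦[bx] (0<k[t] t) (res[k[t]]≡x[t] t) (cheapest-k[t] t≤μ)

      cheapest⇒t≤μ : ∀ {k i t x} → Cheapest k → k ≡ q * i + suc q * t →
                     0 < x → x + t * s ≡ r * i → t ≤ μ
      cheapest⇒t≤μ {k} {i} {t} {x} cheapest k≡ 0<x x+ts≡ri = ≮⇒≥ μ≮t
        where
        μ≮t : μ ≮ t
        μ≮t μ<t = X+Ts≡rI⇒T*B≢I*A {T} {I} (0<x[t] T) (x[t]≤r T) (x[t]+t*s≡r*[1+⌊st/r⌋] T)
                                   (≤-antisym TB≤IA IA≤TB)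
          where
          T = suc μ
          I = suc ((s * T) div r)
          sT<ri : s * T < r * i
          sT<ri = begin-strict
            s * T     ≤⟨ *-monoʳ-≤ s μ<t ⟩
            s * t     ≡⟨ *-comm s t ⟩
            t * s     <⟨ m<n+m (t * s) 0<x ⟩
            x + t * s ≡⟨ x+ts≡ri ⟩
            r * i     ∎
            where open ≤-Reasoning
          k[T]≤k : k[ T ] ≤ k
          k[T]≤k = begin
            k[ T ]            ≤⟨ k[t]≤q*i+[1+q]*t sT<ri ⟩
            q * i + suc q * T ≤⟨ +-monoʳ-≤ (q * i) (*-monoʳ-≤ (suc q) μ<t) ⟩
            q * i + suc q * t ≡⟨ k≡ ⟨
            k                 ∎
            where open ≤-Reasoning
          TB≤IA : T * B ≤ I * A
          TB≤IA = Equivalence.to (c*k≤b*Y⇔t*B≤i*A (x[t]+t*s≡r*[1+⌊st/r⌋] T))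
                    (subst (λ n → c * k[ T ] ≤ b * n) (res[k[t]]≡x[t] T) (cheapest k[ T ] k[T]≤k))
          I≤⌊TB/A⌋ : I ≤ (T * B) div A
          I≤⌊TB/A⌋ = ≤∧≢⇒< (⌊st/r⌋≤⌊tB/A⌋ T)
                       (λ e → differ-at-μ (trans (sym e) (cong (_div r) (*-comm s T))))
          IA≤TB : I * A ≤ T * B
          IA≤TB = ≤-trans (*-monoˡ-≤ A I≤⌊TB/A⌋) (m-div-n*n≤m (T * B) A)

      x∈𝒳⇒x≡x[t] : ∀ {x} → InX a b c r x → ∃ λ t → t ≤ μ × x ≡ x[ t ]
      x∈𝒳⇒x≡x[t] {x} (0<x , x≤r , c∣𝐦[bx])
          with c∣𝐦[bx]⇒cheapest 0<x (≤-<-trans x≤r r<a) c∣𝐦[bx]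
      ... | k , 0<k , resk≡x , cheapest
          with res≤r⇒decomposition 0<k (subst (_≤ r) (sym resk≡x) x≤r)
      ... | i , t , k≡ , resk+ts≡ri = t , cheapest⇒t≤μ cheapest k≡ 0<x x+ts≡ri , x≡x[t]
        where
        x+ts≡ri : x + t * s ≡ r * i
        x+ts≡ri = subst (λ n → n + t * s ≡ r * i) resk≡x resk+ts≡ri
        i≡1+⌊st/r⌋ : i ≡ suc ((s * t) div r)
        i≡1+⌊st/r⌋ = Y+ts≡ri⇒i≡1+⌊st/r⌋ {t = t} {s = s} 0<x x≤r x+ts≡ri
        x≡x[t] : x ≡ x[ t ]
        x≡x[t] = begin
          x                 ≡⟨ m+n∸n≡m x (t * s) ⟨
          x + t * s ∸ t * s ≡⟨ cong₂ _∸_ (trans x+ts≡ri (cong (r *_) i≡1+⌊st/r⌋)) (*-comm t s) ⟩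
          x[ t ]            ∎
          where open ≡-Reasoning

      𝒳-enumeration : ∀ x → InX a b c r x ⇔ (∃ λ t → t ≤ μ × x ≡ x[ t ])
      𝒳-enumeration x = mk⇔ x∈𝒳⇒x≡x[t] λ { (t , t≤μ , refl) → x[t]∈𝒳 t≤μ }

      𝒳≡r∸u*t : 0 < d mod r → μ < r div (d mod r) →
                ∀ x → InX a b c r x ⇔ (∃ λ t → t ≤ μ × x ≡ r ∸ d mod r * t)
      𝒳≡r∸u*t 0<u μ<r/u = reindex refl
        (λ t t≤μ → x[t]≡r∸u*t {t} {d mod r} {s div r} s≡d-mod-r+[s-div-r]*r
                     (m<n-div-o⇒o*m<n (d mod r) {{>-nonZero 0<u}} (≤-<-trans t≤μ μ<r/u)))
        𝒳-enumeration

      ⌊s/r⌋<⌊B/A⌋⇒μ≡0 : s div r < B div A → μ ≡ 0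
      ⌊s/r⌋<⌊B/A⌋⇒μ≡0 ⌊s/r⌋<⌊B/A⌋ = n≤0⇒n≡0 (≮⇒≥ 0≮μ)
        where
        0≮μ : 0 ≮ μ
        0≮μ 0<μ = <⇒≢ ⌊s/r⌋<⌊B/A⌋ (sym (begin
          B div A           ≡⟨ cong (_div A) (*-identityˡ B) ⟨
          (1 * B) div A     ≡⟨ agree-below-μ 0 0<μ ⟩
          (1 * s) div r     ≡⟨ cong (_div r) (*-identityˡ s) ⟩
          s div r           ∎))
          where open ≡-Reasoning

      module _ (Δ<Λ : A div B < r div s) where

        Δ = A div B

        [1+Δ]*s≤r : suc Δ * s ≤ r
        [1+Δ]*s≤r = ≤-trans (*-monoˡ-≤ s Δ<Λ) (m-div-n*n≤m r s)

        t≤Δ⇒s*t<r : ∀ {t} → t ≤ Δ → s * t < r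
        t≤Δ⇒s*t<r {t} t≤Δ = begin-strict
          s * t     ≤⟨ *-monoʳ-≤ s t≤Δ ⟩
          s * Δ     ≡⟨ *-comm s Δ ⟩
          Δ * s     <⟨ m<n+m (Δ * s) 0<s ⟩
          s + Δ * s ≤⟨ [1+Δ]*s≤r ⟩
          r         ∎
          where open ≤-Reasoning

        μ≤Δ : μ ≤ Δ
        μ≤Δ = ≮⇒≥ Δ≮μ
          where
          Δ≮μ : Δ ≮ μ
          Δ≮μ Δ<μ with m≤n⇒m<n∨m≡n [1+Δ]*s≤r
          ... | inj₁ [1+Δ]s<r = n≮0 (begin-strict
            0                   <⟨ 0<⌊[1+Δ]B/A⌋ ⟩
            (suc Δ * B) div A   ≡⟨ agree-below-μ Δ Δ<μ ⟩
            (suc Δ * s) div r   ≡⟨ m<n⇒m-div-n≡0 r [1+Δ]s<r ⟩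
            0                   ∎)
            where
            open ≤-Reasoning
            0<⌊[1+Δ]B/A⌋ : 0 < (suc Δ * B) div A
            0<⌊[1+Δ]B/A⌋ = n*o≤m⇒n≤m-div-o A
              (subst (_≤ suc Δ * B) (sym (+-identityʳ A)) (<⇒≤ (m<[1+m-div-n]*n A B)))
          ... | inj₂ [1+Δ]s≡r = n≮n 1 (begin-strict
            1                   <⟨ 1<⌊rB/A⌋ ⟩
            (r * B) div A       ≡⟨ cong (λ n → (n * B) div A) r≡1+Δ ⟩
            (suc Δ * B) div A   ≡⟨ agree-below-μ Δ Δ<μ ⟩
            (suc Δ * s) div r   ≡⟨ cong (_div r) [1+Δ]s≡r ⟩
            r div r             ≡⟨ n-div-n≡1 r ⟩
            1                   ∎)
            where
            open ≤-Reasoning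
            s≡1 : s ≡ 1
            s≡1 = coprime-r-s a⊥ℓ (divides (suc Δ) (sym [1+Δ]s≡r) , ∣-refl)
            r≡1+Δ : r ≡ suc Δ
            r≡1+Δ = trans (sym [1+Δ]s≡r) (trans (cong (suc Δ *_) s≡1) (*-identityʳ (suc Δ)))
            1<⌊rB/A⌋ : 1 < (r * B) div A
            1<⌊rB/A⌋ = subst (λ n → suc n ≤ (r * B) div A) s≡1 (n*o≤m⇒n≤m-div-o A [1+s]*A≤r*B)

        Δ≤μ : Δ ≤ μ
        Δ≤μ = ≮⇒≥ μ≮Δ
          where
          μ≮Δ : μ ≮ Δ
          μ≮Δ μ<Δ = differ-at-μ (trans ⌊[1+μ]B/A⌋≡0 (sym (m<n⇒m-div-n≡0 r [1+μ]s<r)))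
            where
            [1+μ]s<r : suc μ * s < r
            [1+μ]s<r = subst (_< r) (*-comm s (suc μ)) (t≤Δ⇒s*t<r μ<Δ)
            [1+μ]B≤A : suc μ * B ≤ A
            [1+μ]B≤A = ≤-trans (*-monoˡ-≤ B μ<Δ) (m-div-n*n≤m A B)
            ⌊[1+μ]B/A⌋≡0 : (suc μ * B) div A ≡ 0
            ⌊[1+μ]B/A⌋≡0 = m<n⇒m-div-n≡0 A (≤∧≢⇒< [1+μ]B≤A (T*s<r⇒T*B≢A {suc μ} [1+μ]s<r))

        μ≡Δ : μ ≡ Δ
        μ≡Δ = ≤-antisym μ≤Δ Δ≤μ

      𝒳≡r∸s*t : (A div B < r div s ⊎ s div r < B div A) →
                ∀ x → InX a b c r x ⇔ (∃ λ t → t ≤ A div B × x ≡ r ∸ s * t)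
      𝒳≡r∸s*t (inj₁ Δ<Λ) = reindex (μ≡Δ Δ<Λ)
        (λ t t≤μ → x[t]≡r∸s*t (t≤Δ⇒s*t<r Δ<Λ (subst (t ≤_) (μ≡Δ Δ<Λ) t≤μ)))
        𝒳-enumeration
      𝒳≡r∸s*t (inj₂ Λ′<Δ′) = reindex (trans μ≡0 (sym Δ≡0))
        (λ t t≤μ → x[t]≡r∸s*t (s*t<r (n≤0⇒n≡0 (subst (t ≤_) μ≡0 t≤μ))))
        𝒳-enumeration
        where
        s*t<r : ∀ {t} → t ≡ 0 → s * t < r
        s*t<r refl = subst (_< r) (sym (*-zeroʳ s)) 0<r
        μ≡0 : μ ≡ 0
        μ≡0 = ⌊s/r⌋<⌊B/A⌋⇒μ≡0 Λ′<Δ′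
        Δ≡0 : A div B ≡ 0
        Δ≡0 = m<n⇒m-div-n≡0 B (⌊s/r⌋<⌊B/A⌋⇒A<B Λ′<Δ′)

mainTheorem8 :
  (a b c ℓ : ℕ) → 2 ≤ a → a < b → b < c →
  Coprime a b → Coprime b c → Coprime a c →
  ℓ < a → (ℓ * b) mod a ≡ c mod a →
  let k = c div b
      q = a div (a ∸ ℓ)
      r = a ∸ q * (a ∸ ℓ)
      u = (a ∸ ℓ) mod r
      s = a ∸ ℓ ∸ r
      A = b * r ∸ c * q
      B = b * s + c * suc q
      Λ = r div s
      Δ = A div B
      Λ' = s div r
      Δ' = B div A
  in k < ℓ → c * q < b * r →
     (μ : ℕ) →
     ((suc μ * B) div A ≢ (suc μ * s) div r) →
     (∀ i → i < μ → (suc i * B) div A ≡ (suc i * s) div r) →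
     (∀ x → InX a b c r x ⇔ (∃ λ t → t ≤ μ × x ≡ r * suc ((s * t) div r) ∸ s * t))
     × (0 < u → μ < r div u →
          ∀ x → InX a b c r x ⇔ (∃ λ t → t ≤ μ × x ≡ r ∸ u * t))
     × ((Δ < Λ ⊎ Λ' < Δ') →
          ∀ x → InX a b c r x ⇔ (∃ λ t → t ≤ Δ × x ≡ r ∸ s * t))
mainTheorem8 zero _ _ _ ()
mainTheorem8 a@(suc _) b c ℓ _ a<b b<c a⊥b b⊥c a⊥c ℓ<a ℓb≡c _ cq<br μ differ-at-μ agree-below-μ =
  𝒳-enumeration , 𝒳≡r∸u*t , 𝒳≡r∸s*t
  where
  open Setting a b c ℓ ℓ<a a<b b<c a⊥b b⊥c a⊥c ℓb≡c
  open Enumeration cq<br μ differ-at-μ agree-below-μ
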